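{- There is an absolute constant $C>0$ such that the following holds. Let $D,d,e,n\in\mathbb{N}$ with $D>2$ and $0\le e\le d\le 2n/D$. Consider directed $D$-uniform hypergraphs on vertex set $[n]$ with exactly $e$ unlabeled hyperedges (each hyperedge an ordered $D$-tuple in $[n]^D$; parallel edges and repeated vertices allowed) in which every vertex has even degree (the degree of $i$ being the total number of occurrences of $i$ among all hyperedge tuples). If $De$ is even, the number of such hypergraphs is at most $(CDn)^{De/2}\,e^{(\frac D2-1)e}$; if $De$ is odd, there are no such hypergraphs.
   Context: Here $e^{(\frac D2-1)e}$ means the number of edges $e$ raised to the power $(\frac D2-1)e$ (with $0^0=1$), not the exponential. -}

module Defs where

open import Data.Nat using (ℕ; zero; suc; _+_; _*_; _≤ᵇ_; _%_)
open import Data.Nat.Properties using ()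
open import Data.Bool using (Bool; true; false; _∧_; if_then_else_)
open import Data.Fin using (Fin; toℕ)
open import Data.Fin.Properties using () renaming (_≟_ to _≟F_)
open import Data.Vec using (Vec; []; _∷_)
open import Data.List using (List; []; _∷_; map; concatMap; allFin; length; filterᵇ; sum)
open import Relation.Nullary using (does)

allVecs : {A : Set} → List A → (k : ℕ) → List (Vec A k)
allVecs xs zero    = [] ∷ []
allVecs xs (suc k) = concatMap (λ x → map (x ∷_) (allVecs xs k)) xs

Tuple : ℕ → ℕ → Set
Tuple n D = Vec (Fin n) D

-- Base-n encoding of a tuple; injective on Tuple n D.  Used only to fix a
-- canonical ordering of hyperedges.
tupleKey : {n D : ℕ} → Tuple n D → ℕ
tupleKey []               = 0
tupleKey {n} (x ∷ xs)     = toℕ x + n * tupleKey xs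

-- Canonical representative of an unlabeled (multi)set of e hyperedges:
-- a length-e sequence of tuples whose keys are nondecreasing.
-- Multisets of e tuples are in bijection with such sorted sequences.
sortedᵇ : {n D e : ℕ} → Vec (Tuple n D) e → Bool
sortedᵇ []                 = true
sortedᵇ (t ∷ [])           = true
sortedᵇ (t ∷ (u ∷ ts))     = (tupleKey t ≤ᵇ tupleKey u) ∧ sortedᵇ (u ∷ ts)

occ : {n D : ℕ} → Fin n → Tuple n D → ℕ
occ i []       = 0
occ i (x ∷ xs) = (if does (i ≟F x) then 1 else 0) + occ i xs

degree : {n D e : ℕ} → Fin n → Vec (Tuple n D) e → ℕ
degree i []       = 0
degree i (t ∷ ts) = occ i t + degree i ts

allᵇ : {A : Set} → (A → Bool) → List A → Bool
allᵇ p []       = true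
allᵇ p (x ∷ xs) = p x ∧ allᵇ p xs

evenᵇ : ℕ → Bool
evenᵇ m = (m % 2) Data.Nat.≡ᵇ 0

allDegreesEven : {n D e : ℕ} → Vec (Tuple n D) e → Bool
allDegreesEven {n} H = allᵇ (λ i → evenᵇ (degree i H)) (allFin n)

countEvenHypergraphs : (D n e : ℕ) → ℕ
countEvenHypergraphs D n e =
  length (filterᵇ (λ H → sortedᵇ H ∧ allDegreesEven H)
                  (allVecs (allVecs (allFin n) D) e))

-- A counted hypergraph lives on its support S, the vertices of positive degree; since every degree
-- is even and the degrees sum to De = 2m, |S| ≤ m. Sorting by tupleKey makes the last coordinates
-- of the edges nondecreasing, so for fixed S there are at most 2^(e+|S|) choices for them and
-- |S|^(D-1) for the rest of each edge. There are C(n,j) ≤ (4n)^j / j^j supports of size j, and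
-- j^((D-1)e) = j^j j^(m-j) j^(m-e) ≤ j^j n^(m-j) (De)^(m-e); summing over j ≤ m gives C = 32.
-- If De is odd, the degree sum is odd, so some degree is odd.
module Submission where

open import Data.Bool using (Bool; true; false; _∧_; if_then_else_; T)
open import Data.Bool.Properties using (∧-conicalˡ; ∧-conicalʳ; ∧-zeroʳ; ∧-identityʳ; T-≡)
open import Data.Fin using (Fin; zero; suc; toℕ)
open import Data.Fin.Properties using (toℕ<n) renaming (_≟_ to _≟ᶠ_)
open import Data.Fin.Subset using (Subset)
open import Data.List using (List; []; _∷_; _++_; map; concatMap; length; filterᵇ; allFin; downFrom)
open import Data.List.Properties using (map-tabulate; length-downFrom)
open import Data.List.Membership.Propositional using (_∈_)
open import Data.List.Membership.Propositional.Properties using (∈-map⁺; ∈-++⁺ˡ; ∈-++⁺ʳ; ∈-downFrom⁺; ∈-downFrom⁻)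
open import Data.List.Relation.Unary.Any using (here; there)
open import Data.Nat
open import Data.Nat.Properties
open import Data.Nat.DivMod using (m≡m%n+[m/n]*n; m*n/n≡m; %-distribˡ-+)
open import Data.Nat.Tactic.RingSolver using (solve-∀)
open import Data.Product using (Σ; _×_; _,_)
open import Data.Vec using (Vec; []; _∷_; lookup; last)
import Data.Vec as Vec
open import Data.Vec.Properties using (lookup∘tabulate)
open import Function using (_∘_; id)
open import Function.Bundles using (Equivalence)
open import Relation.Binary.PropositionalEquality
open import Relation.Nullary using (does; yes; no; contradiction)
open import Relation.Nullary.Decidable using (dec-true)

open import Defs

private
  variable
    A B : Set
    k n D e : ℕ

⟦_⟧ : Bool → ℕ
⟦ true  ⟧ = 1
⟦ false ⟧ = 0

⟦∧⟧ : ∀ a b → ⟦ a ∧ b ⟧ ≡ ⟦ a ⟧ * ⟦ b ⟧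
⟦∧⟧ true  b = sym (+-identityʳ ⟦ b ⟧)
⟦∧⟧ false b = refl

T⇒≡true : ∀ {b} → T b → b ≡ true
T⇒≡true = Equivalence.to T-≡

≡true⇒T : ∀ {b} → b ≡ true → T b
≡true⇒T = Equivalence.from T-≡

∑ : List A → (A → ℕ) → ℕ
∑ []       f = 0
∑ (x ∷ xs) f = f x + ∑ xs f

syntax ∑ xs (λ x → f) = ∑[ x ∈ xs ] f

length-filterᵇ : (p : A → Bool) (xs : List A) → length (filterᵇ p xs) ≡ ∑[ x ∈ xs ] ⟦ p x ⟧
length-filterᵇ p [] = refl
length-filterᵇ p (x ∷ xs) with p x
... | true  = cong suc (length-filterᵇ p xs)
... | false = length-filterᵇ p xs

∑-cong : (xs : List A) {f g : A → ℕ} → (∀ {x} → x ∈ xs → f x ≡ g x) → ∑ xs f ≡ ∑ xs g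
∑-cong []       eq = refl
∑-cong (x ∷ xs) eq = cong₂ _+_ (eq (here refl)) (∑-cong xs (eq ∘ there))

∑-mono-≤ : (xs : List A) {f g : A → ℕ} → (∀ {x} → x ∈ xs → f x ≤ g x) → ∑ xs f ≤ ∑ xs g
∑-mono-≤ []       le = z≤n
∑-mono-≤ (x ∷ xs) le = +-mono-≤ (le (here refl)) (∑-mono-≤ xs (le ∘ there))

∈⇒≤∑ : {xs : List A} {x : A} (f : A → ℕ) → x ∈ xs → f x ≤ ∑ xs f
∈⇒≤∑ f (here refl)                = m≤m+n _ _
∈⇒≤∑ {xs = y ∷ _} f (there x∈xs) = ≤-trans (∈⇒≤∑ f x∈xs) (m≤n+m _ (f y))

∑-const : (xs : List A) (c : ℕ) → ∑[ _ ∈ xs ] c ≡ length xs * c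
∑-const []       c = refl
∑-const (x ∷ xs) c = cong (c +_) (∑-const xs c)

∑-zero : (xs : List A) → ∑[ _ ∈ xs ] 0 ≡ 0
∑-zero xs = trans (∑-const xs 0) (*-zeroʳ (length xs))

∑-++ : (xs ys : List A) (f : A → ℕ) → ∑ (xs ++ ys) f ≡ ∑ xs f + ∑ ys f
∑-++ []       ys f = refl
∑-++ (x ∷ xs) ys f = trans (cong (f x +_) (∑-++ xs ys f)) (sym (+-assoc (f x) _ _))

∑-map : (g : A → B) (xs : List A) (f : B → ℕ) → ∑ (map g xs) f ≡ ∑[ x ∈ xs ] f (g x)
∑-map g []       f = refl
∑-map g (x ∷ xs) f = cong (f (g x) +_) (∑-map g xs f)

∑-concatMap : (g : A → List B) (xs : List A) (f : B → ℕ) →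
  ∑ (concatMap g xs) f ≡ ∑[ x ∈ xs ] ∑ (g x) f
∑-concatMap g []       f = refl
∑-concatMap g (x ∷ xs) f =
  trans (∑-++ (g x) (concatMap g xs) f) (cong (∑ (g x) f +_) (∑-concatMap g xs f))

∑-distrib-+ : (xs : List A) (f g : A → ℕ) → ∑[ x ∈ xs ] (f x + g x) ≡ ∑ xs f + ∑ xs g
∑-distrib-+ []       f g = refl
∑-distrib-+ (x ∷ xs) f g = trans (cong (f x + g x +_) (∑-distrib-+ xs f g))
                                 (+-+-comm (f x) (g x) (∑ xs f) (∑ xs g))
  where
  +-+-comm : ∀ a b c d → a + b + (c + d) ≡ a + c + (b + d)
  +-+-comm = solve-∀

*-distribˡ-∑ : (c : ℕ) (xs : List A) (f : A → ℕ) → c * ∑ xs f ≡ ∑[ x ∈ xs ] (c * f x)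
*-distribˡ-∑ c []       f = *-zeroʳ c
*-distribˡ-∑ c (x ∷ xs) f = trans (*-distribˡ-+ c (f x) (∑ xs f)) (cong (c * f x +_) (*-distribˡ-∑ c xs f))

*-distribʳ-∑ : (c : ℕ) (xs : List A) (f : A → ℕ) → ∑ xs f * c ≡ ∑[ x ∈ xs ] (f x * c)
*-distribʳ-∑ c xs f = trans (*-comm (∑ xs f) c)
  (trans (*-distribˡ-∑ c xs f) (∑-cong xs (λ {x} _ → *-comm c (f x))))

∑-comm : (xs : List A) (ys : List B) (h : A → B → ℕ) →
  ∑[ x ∈ xs ] ∑[ y ∈ ys ] h x y ≡ ∑[ y ∈ ys ] ∑[ x ∈ xs ] h x y
∑-comm []       ys h = sym (∑-zero ys)
∑-comm (x ∷ xs) ys h = trans (cong (∑ ys (h x) +_) (∑-comm xs ys h))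
                             (sym (∑-distrib-+ ys (h x) (λ y → ∑[ x′ ∈ xs ] h x′ y)))

∑-allFin-suc : (n : ℕ) (g : Fin (suc n) → ℕ) → ∑ (allFin (suc n)) g ≡ g zero + ∑[ i ∈ allFin n ] g (suc i)
∑-allFin-suc n g = cong (g zero +_)
  (trans (cong (λ is → ∑ is g) (sym (map-tabulate id suc))) (∑-map suc (allFin n) g))

∑-even : (xs : List A) {f : A → ℕ} → (∀ {x} → x ∈ xs → f x % 2 ≡ 0) → ∑ xs f % 2 ≡ 0
∑-even []           ev = refl
∑-even (x ∷ xs) {f} ev = begin
  (f x + ∑ xs f) % 2            ≡⟨ %-distribˡ-+ (f x) (∑ xs f) 2 ⟩
  (f x % 2 + ∑ xs f % 2) % 2    ≡⟨ cong₂ (λ a b → (a + b) % 2) (ev (here refl)) (∑-even xs (ev ∘ there)) ⟩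
  0                             ∎
  where open ≡-Reasoning

allᵇ-∈ : {p : A → Bool} {xs : List A} {x : A} → allᵇ p xs ≡ true → x ∈ xs → p x ≡ true
allᵇ-∈ {p = p} {x ∷ _} all (here refl)   = ∧-conicalˡ (p x) _ all
allᵇ-∈ {p = p} {y ∷ _} all (there x∈xs) = allᵇ-∈ (∧-conicalʳ (p y) _ all) x∈xs

δ : Fin n → Fin n → ℕ
δ i y = if does (i ≟ᶠ y) then 1 else 0

δ-refl : (x : Fin n) → δ x x ≡ 1
δ-refl x rewrite dec-true (x ≟ᶠ x) refl = refl

∑-δ : (y : Fin n) → ∑[ i ∈ allFin n ] δ i y ≡ 1
∑-δ {suc n} zero    = trans (∑-allFin-suc n (λ i → δ i zero)) (cong suc (∑-zero (allFin n)))
∑-δ {suc n} (suc y) = trans (∑-allFin-suc n (λ i → δ i (suc y))) (∑-δ y)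

∑-occ : (t : Tuple n D) → ∑[ i ∈ allFin n ] occ i t ≡ D
∑-occ {n} []      = ∑-zero (allFin n)
∑-occ {n} (x ∷ t) = trans (∑-distrib-+ (allFin n) _ (λ i → occ i t)) (cong₂ _+_ (∑-δ x) (∑-occ t))

∑-degree : (H : Vec (Tuple n D) e) → ∑[ i ∈ allFin n ] degree i H ≡ e * D
∑-degree {n} []      = ∑-zero (allFin n)
∑-degree {n} (t ∷ H) = trans (∑-distrib-+ (allFin n) (λ i → occ i t) (λ i → degree i H))
                             (cong₂ _+_ (∑-occ t) (∑-degree H))

evenᵇ⇒%2≡0 : ∀ m → evenᵇ m ≡ true → m % 2 ≡ 0
evenᵇ⇒%2≡0 m ev = ≡ᵇ⇒≡ (m % 2) 0 (≡true⇒T ev)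

allDegreesEven⇒e*D%2≡0 : (H : Vec (Tuple n D) e) → allDegreesEven H ≡ true → (e * D) % 2 ≡ 0
allDegreesEven⇒e*D%2≡0 {n} H ev = subst (λ s → s % 2 ≡ 0) (∑-degree H)
  (∑-even (allFin n) (λ {i} i∈ → evenᵇ⇒%2≡0 (degree i H) (allᵇ-∈ {p = λ j → evenᵇ (degree j H)} ev i∈)))

hypergraphs : (n D e : ℕ) → List (Vec (Tuple n D) e)
hypergraphs n D e = allVecs (allVecs (allFin n) D) e

countedᵇ : Vec (Tuple n D) e → Bool
countedᵇ H = sortedᵇ H ∧ allDegreesEven H

countEvenHypergraphs≡∑ : (D n e : ℕ) → countEvenHypergraphs D n e ≡ ∑[ H ∈ hypergraphs n D e ] ⟦ countedᵇ H ⟧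
countEvenHypergraphs≡∑ D n e = length-filterᵇ countedᵇ (hypergraphs n D e)

countEvenHypergraphs-odd : (D n e : ℕ) → (D * e) % 2 ≡ 1 → countEvenHypergraphs D n e ≡ 0
countEvenHypergraphs-odd D n e odd = begin
  countEvenHypergraphs D n e                    ≡⟨ countEvenHypergraphs≡∑ D n e ⟩
  ∑[ H ∈ hypergraphs n D e ] ⟦ countedᵇ H ⟧     ≡⟨ ∑-cong (hypergraphs n D e) (λ {H} _ → notCounted H) ⟩
  ∑[ _ ∈ hypergraphs n D e ] 0                  ≡⟨ ∑-zero (hypergraphs n D e) ⟩
  0                                             ∎
  where
  open ≡-Reasoning
  notCounted : (H : Vec (Tuple n D) e) → ⟦ countedᵇ H ⟧ ≡ 0
  notCounted H with allDegreesEven H in ev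
  ... | false = cong ⟦_⟧ (∧-zeroʳ (sortedᵇ H))
  ... | true  with () ← trans (sym odd) (trans (cong (_% 2) (*-comm D e)) (allDegreesEven⇒e*D%2≡0 H ev))

size : Subset n → ℕ
size {n} S = ∑[ i ∈ allFin n ] ⟦ lookup S i ⟧

support : Vec (Tuple n D) e → Subset n
support H = Vec.tabulate (λ i → 0 <ᵇ degree i H)

2*size-support≤ : (H : Vec (Tuple n D) e) → allDegreesEven H ≡ true → 2 * size (support H) ≤ e * D
2*size-support≤ {n} {D} {e} H ev = begin
  2 * size (support H)                                ≡⟨ *-distribˡ-∑ 2 (allFin n) _ ⟩
  ∑[ i ∈ allFin n ] (2 * ⟦ lookup (support H) i ⟧)   ≤⟨ ∑-mono-≤ (allFin n) (λ {i} i∈ → twice-indicator≤ i i∈) ⟩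
  ∑[ i ∈ allFin n ] degree i H                        ≡⟨ ∑-degree H ⟩
  e * D                                               ∎
  where
  open ≤-Reasoning
  even⇒2*positive≤ : ∀ m → m % 2 ≡ 0 → 2 * ⟦ 0 <ᵇ m ⟧ ≤ m
  even⇒2*positive≤ zero          _ = z≤n
  even⇒2*positive≤ (suc (suc m)) _ = s≤s (s≤s z≤n)
  twice-indicator≤ : ∀ i → i ∈ allFin n → 2 * ⟦ lookup (support H) i ⟧ ≤ degree i H
  twice-indicator≤ i i∈ rewrite lookup∘tabulate (λ j → 0 <ᵇ degree j H) i =
    even⇒2*positive≤ (degree i H) (evenᵇ⇒%2≡0 (degree i H) (allᵇ-∈ {p = λ j → evenᵇ (degree j H)} ev i∈))

within : Subset n → Tuple n D → Bool
within S []      = true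
within S (x ∷ t) = lookup S x ∧ within S t

allWithin : Subset n → Vec (Tuple n D) e → Bool
allWithin S []      = true
allWithin S (t ∷ H) = within S t ∧ allWithin S H

within-positive : (g : Fin n → ℕ) (t : Tuple n D) → (∀ i → occ i t ≤ g i) →
  within (Vec.tabulate (λ i → 0 <ᵇ g i)) t ≡ true
within-positive g []      _  = refl
within-positive g (x ∷ t) le rewrite lookup∘tabulate (λ i → 0 <ᵇ g i) x =
  cong₂ _∧_ (positive (≤-trans (subst (_≤ occ x (x ∷ t)) (δ-refl x) (m≤m+n (δ x x) (occ x t))) (le x)))
            (within-positive g t (λ i → ≤-trans (m≤n+m (occ i t) (δ i x)) (le i)))
  where
  positive : ∀ {m} → 1 ≤ m → (0 <ᵇ m) ≡ true
  positive (s≤s _) = refl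

allWithin-positive : (g : Fin n → ℕ) (H : Vec (Tuple n D) e) → (∀ i → degree i H ≤ g i) →
  allWithin (Vec.tabulate (λ i → 0 <ᵇ g i)) H ≡ true
allWithin-positive g []      _  = refl
allWithin-positive g (t ∷ H) le =
  cong₂ _∧_ (within-positive g t (λ i → ≤-trans (m≤m+n _ _) (le i)))
            (allWithin-positive g H (λ i → ≤-trans (m≤n+m _ _) (le i)))

allWithin-support : (H : Vec (Tuple n D) e) → allWithin (support H) H ≡ true
allWithin-support H = allWithin-positive (λ i → degree i H) H (λ _ → ≤-refl)

base-digits-≤⇒≤ : (x y : Fin n) (a b : ℕ) → toℕ x + n * a ≤ toℕ y + n * b → a ≤ b
base-digits-≤⇒≤ {n} x y a b le with a ≤? b
... | yes a≤b = a≤b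
... | no  a≰b = contradiction le (<⇒≱ (begin-strict
  toℕ y + n * b  <⟨ +-monoˡ-< (n * b) (toℕ<n y) ⟩
  n + n * b      ≡⟨ *-suc n b ⟨
  n * suc b      ≤⟨ *-monoʳ-≤ n (≰⇒> a≰b) ⟩
  n * a          ≤⟨ m≤n+m (n * a) (toℕ x) ⟩
  toℕ x + n * a  ∎))
  where open ≤-Reasoning

-- The last coordinate is the most significant digit of tupleKey.
tupleKey-≤⇒last-≤ : (t u : Tuple n (suc k)) → tupleKey t ≤ tupleKey u → toℕ (last t) ≤ toℕ (last u)
tupleKey-≤⇒last-≤ {n} (x ∷ [])          (y ∷ [])          le = +-cancelʳ-≤ (n * 0) (toℕ x) (toℕ y) le
tupleKey-≤⇒last-≤     (x ∷ t@(_ ∷ _)) (y ∷ u@(_ ∷ _)) le =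
  tupleKey-≤⇒last-≤ t u (base-digits-≤⇒≤ x y (tupleKey t) (tupleKey u) le)

lastsAscendFrom : ℕ → Vec (Tuple n (suc k)) e → Bool
lastsAscendFrom a []      = true
lastsAscendFrom a (t ∷ H) = (a ≤ᵇ toℕ (last t)) ∧ lastsAscendFrom (toℕ (last t)) H

sorted⇒lastsAscend : (H : Vec (Tuple n (suc k)) e) → sortedᵇ H ≡ true → lastsAscendFrom 0 H ≡ true
sorted⇒lastsAscend []      _      = refl
sorted⇒lastsAscend (t ∷ H) sorted = ascendAfter t H sorted
  where
  ascendAfter : (t : Tuple _ _) (H : Vec _ e) → sortedᵇ (t ∷ H) ≡ true → lastsAscendFrom (toℕ (last t)) H ≡ true
  ascendAfter t []      _      = refl
  ascendAfter t (u ∷ H) sorted = cong₂ _∧_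
    (T⇒≡true (≤⇒≤ᵇ (tupleKey-≤⇒last-≤ t u (≤ᵇ⇒≤ _ _ (≡true⇒T (∧-conicalˡ _ _ sorted))))))
    (ascendAfter u H (∧-conicalʳ _ _ sorted))

≤ᵇ-suc : ∀ a x → (suc a ≤ᵇ suc x) ≡ (a ≤ᵇ x)
≤ᵇ-suc zero    x = refl
≤ᵇ-suc (suc a) x = refl

atOrAbove : Subset n → ℕ → ℕ
atOrAbove {n} S a = ∑[ x ∈ allFin n ] (⟦ lookup S x ⟧ * ⟦ a ≤ᵇ toℕ x ⟧)

size≡atOrAbove-0 : (S : Subset n) → size S ≡ atOrAbove S 0
size≡atOrAbove-0 {n} S = ∑-cong (allFin n) (λ {x} _ → sym (*-identityʳ ⟦ lookup S x ⟧))

atOrAbove-∷-0 : (b : Bool) (S : Subset n) → atOrAbove (b ∷ S) 0 ≡ ⟦ b ⟧ + atOrAbove S 0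
atOrAbove-∷-0 {n} b S = trans (∑-allFin-suc n _) (cong (_+ atOrAbove S 0) (*-identityʳ ⟦ b ⟧))

atOrAbove-∷-suc : (b : Bool) (S : Subset n) (a : ℕ) → atOrAbove (b ∷ S) (suc a) ≡ atOrAbove S a
atOrAbove-∷-suc {n} b S a = trans (∑-allFin-suc n _) (cong₂ _+_ (*-zeroʳ ⟦ b ⟧)
  (∑-cong (allFin n) (λ {x} _ → cong (λ c → ⟦ lookup S x ⟧ * ⟦ c ⟧) (≤ᵇ-suc a (toℕ x)))))

geometricSum : Subset n → ℕ → ℕ
geometricSum {n} S a = ∑[ x ∈ allFin n ] (⟦ lookup S x ⟧ * (⟦ a ≤ᵇ toℕ x ⟧ * 2 ^ atOrAbove S (toℕ x)))

geometricSum-∷-0 : (b : Bool) (S : Subset n) →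
  geometricSum (b ∷ S) 0 ≡ ⟦ b ⟧ * 2 ^ (⟦ b ⟧ + atOrAbove S 0) + geometricSum S 0
geometricSum-∷-0 {n} b S = trans (∑-allFin-suc n _) (cong₂ _+_
  (cong (λ c → ⟦ b ⟧ * c) (trans (+-identityʳ _) (cong (2 ^_) (atOrAbove-∷-0 b S))))
  (∑-cong (allFin n) (λ {x} _ → cong (λ c → ⟦ lookup S x ⟧ * (1 * 2 ^ c)) (atOrAbove-∷-suc b S (toℕ x)))))

geometricSum-∷-suc : (b : Bool) (S : Subset n) (a : ℕ) → geometricSum (b ∷ S) (suc a) ≡ geometricSum S a
geometricSum-∷-suc {n} b S a = trans (∑-allFin-suc n _) (cong₂ _+_ (*-zeroʳ ⟦ b ⟧)
  (∑-cong (allFin n) (λ {x} _ → cong₂ (λ c d → ⟦ lookup S x ⟧ * (⟦ c ⟧ * 2 ^ d))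
                                      (≤ᵇ-suc a (toℕ x)) (atOrAbove-∷-suc b S (toℕ x)))))

geometricSum+2 : (S : Subset n) (a : ℕ) → geometricSum S a + 2 ≡ 2 ^ suc (atOrAbove S a)
geometricSum+2 []      a       = refl
geometricSum+2 (b ∷ S) (suc a) = begin
  geometricSum (b ∷ S) (suc a) + 2   ≡⟨ cong (_+ 2) (geometricSum-∷-suc b S a) ⟩
  geometricSum S a + 2               ≡⟨ geometricSum+2 S a ⟩
  2 ^ suc (atOrAbove S a)            ≡⟨ cong (λ c → 2 ^ suc c) (atOrAbove-∷-suc b S a) ⟨
  2 ^ suc (atOrAbove (b ∷ S) (suc a)) ∎
  where open ≡-Reasoning
geometricSum+2 (b ∷ S) zero    = begin
  geometricSum (b ∷ S) 0 + 2                                ≡⟨ cong (_+ 2) (geometricSum-∷-0 b S) ⟩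
  ⟦ b ⟧ * 2 ^ (⟦ b ⟧ + c) + geometricSum S 0 + 2            ≡⟨ +-assoc _ (geometricSum S 0) 2 ⟩
  ⟦ b ⟧ * 2 ^ (⟦ b ⟧ + c) + (geometricSum S 0 + 2)          ≡⟨ cong (⟦ b ⟧ * 2 ^ (⟦ b ⟧ + c) +_) (geometricSum+2 S 0) ⟩
  ⟦ b ⟧ * 2 ^ (⟦ b ⟧ + c) + 2 ^ suc c                       ≡⟨ doubling b ⟩
  2 ^ suc (⟦ b ⟧ + c)                                       ≡⟨ cong (λ c → 2 ^ suc c) (atOrAbove-∷-0 b S) ⟨
  2 ^ suc (atOrAbove (b ∷ S) 0)                             ∎
  where
  open ≡-Reasoning
  c = atOrAbove S 0
  doubling : ∀ b → ⟦ b ⟧ * 2 ^ (⟦ b ⟧ + c) + 2 ^ suc c ≡ 2 ^ suc (⟦ b ⟧ + c)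
  doubling false = refl
  doubling true  = x+x≡2x (2 ^ suc c)
    where
    x+x≡2x : ∀ x → 1 * x + x ≡ 2 * x
    x+x≡2x = solve-∀

∑-within-by-last : (S : Subset n) (xs : List (Fin n)) (k : ℕ) (ψ : Fin n → ℕ) →
  ∑[ t ∈ allVecs xs (suc k) ] (⟦ within S t ⟧ * ψ (last t))
    ≡ (∑[ x ∈ xs ] ⟦ lookup S x ⟧) ^ k * ∑[ x ∈ xs ] (⟦ lookup S x ⟧ * ψ x)
∑-within-by-last S xs zero ψ = begin
  ∑ (concatMap (λ x → map (x ∷_) ([] ∷ [])) xs) g  ≡⟨ ∑-concatMap _ xs g ⟩
  ∑[ x ∈ xs ] (⟦ lookup S x ∧ true ⟧ * ψ x + 0)    ≡⟨ ∑-cong xs (λ {x} _ → trans (+-identityʳ _)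
                                                        (cong (λ b → ⟦ b ⟧ * ψ x) (∧-identityʳ (lookup S x)))) ⟩
  ∑[ x ∈ xs ] (⟦ lookup S x ⟧ * ψ x)               ≡⟨ *-identityˡ _ ⟨
  1 * ∑[ x ∈ xs ] (⟦ lookup S x ⟧ * ψ x)           ∎
  where
  open ≡-Reasoning
  g : Vec (Fin _) 1 → ℕ
  g t = ⟦ within S t ⟧ * ψ (last t)
∑-within-by-last {n} S xs (suc k) ψ = begin
  ∑ (allVecs xs (suc (suc k))) g
    ≡⟨ ∑-concatMap _ xs g ⟩
  ∑[ x ∈ xs ] ∑ (map (x ∷_) V) g
    ≡⟨ ∑-cong xs (λ {x} _ → ∑-map (x ∷_) V g) ⟩
  ∑[ x ∈ xs ] ∑[ t ∈ V ] g (x ∷ t)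
    ≡⟨ ∑-cong xs (λ {x} _ → ∑-cong V (λ {t} _ → peel x t)) ⟩
  ∑[ x ∈ xs ] ∑[ t ∈ V ] (⟦ lookup S x ⟧ * g t)
    ≡⟨ ∑-cong xs (λ {x} _ → *-distribˡ-∑ ⟦ lookup S x ⟧ V g) ⟨
  ∑[ x ∈ xs ] (⟦ lookup S x ⟧ * ∑ V g)
    ≡⟨ ∑-cong xs (λ {x} _ → cong (⟦ lookup S x ⟧ *_) (∑-within-by-last S xs k ψ)) ⟩
  ∑[ x ∈ xs ] (⟦ lookup S x ⟧ * (s ^ k * R))
    ≡⟨ *-distribʳ-∑ (s ^ k * R) xs _ ⟨
  s * (s ^ k * R)
    ≡⟨ *-assoc s (s ^ k) R ⟨
  s * s ^ k * R
    ∎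
  where
  open ≡-Reasoning
  V = allVecs xs (suc k)
  s = ∑[ x ∈ xs ] ⟦ lookup S x ⟧
  R = ∑[ x ∈ xs ] (⟦ lookup S x ⟧ * ψ x)
  g : ∀ {j} → Vec (Fin n) (suc j) → ℕ
  g t = ⟦ within S t ⟧ * ψ (last t)
  peel : ∀ x (t : Vec (Fin _) (suc k)) → g (x ∷ t) ≡ ⟦ lookup S x ⟧ * g t
  peel x t@(_ ∷ _) = trans (cong (_* ψ (last t)) (⟦∧⟧ (lookup S x) (within S t))) (*-assoc ⟦ lookup S x ⟧ _ _)

ascendingWithin : Subset n → ℕ → Vec (Tuple n (suc k)) e → Bool
ascendingWithin S a H = lastsAscendFrom a H ∧ allWithin S H

#ascendingWithin : Subset n → (k e a : ℕ) → ℕ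
#ascendingWithin {n} S k e a = ∑[ H ∈ hypergraphs n (suc k) e ] ⟦ ascendingWithin S a H ⟧

#ascendingWithin-suc : (S : Subset n) (k e a : ℕ) →
  #ascendingWithin S k (suc e) a
    ≡ ∑[ t ∈ allVecs (allFin n) (suc k) ]
        (⟦ within S t ⟧ * (⟦ a ≤ᵇ toℕ (last t) ⟧ * #ascendingWithin S k e (toℕ (last t))))
#ascendingWithin-suc {n} S k e a = begin
  ∑ (concatMap (λ t → map (t ∷_) Hs) U) count
    ≡⟨ ∑-concatMap _ U count ⟩
  ∑[ t ∈ U ] ∑ (map (t ∷_) Hs) count
    ≡⟨ ∑-cong U (λ {t} _ → ∑-map (t ∷_) Hs count) ⟩
  ∑[ t ∈ U ] ∑[ H ∈ Hs ] count (t ∷ H)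
    ≡⟨ ∑-cong U (λ {t} _ → ∑-cong Hs (λ {H} _ → split t H)) ⟩
  ∑[ t ∈ U ] ∑[ H ∈ Hs ] (⟦ within S t ⟧ * (⟦ a ≤ᵇ l t ⟧ * count′ t H))
    ≡⟨ ∑-cong U (λ {t} _ → trans (cong (⟦ within S t ⟧ *_) (*-distribˡ-∑ ⟦ a ≤ᵇ l t ⟧ Hs (count′ t)))
                                 (*-distribˡ-∑ ⟦ within S t ⟧ Hs _)) ⟨
  ∑[ t ∈ U ] (⟦ within S t ⟧ * (⟦ a ≤ᵇ l t ⟧ * #ascendingWithin S k e (l t)))
    ∎
  where
  open ≡-Reasoning
  U = allVecs (allFin n) (suc k)
  Hs = allVecs U e
  l : Tuple n (suc k) → ℕ
  l t = toℕ (last t)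
  count : ∀ {j} → Vec (Tuple n (suc k)) j → ℕ
  count H = ⟦ ascendingWithin S a H ⟧
  count′ : Tuple n (suc k) → Vec (Tuple n (suc k)) e → ℕ
  count′ t H = ⟦ ascendingWithin S (l t) H ⟧
  rearrange : ∀ p q r s → ⟦ (p ∧ q) ∧ (r ∧ s) ⟧ ≡ ⟦ r ⟧ * (⟦ p ⟧ * ⟦ q ∧ s ⟧)
  rearrange true  q true  s = sym (trans (*-identityˡ _) (*-identityˡ _))
  rearrange true  q false s = cong ⟦_⟧ (∧-zeroʳ q)
  rearrange false q r     s = sym (*-zeroʳ ⟦ r ⟧)
  split : ∀ t H → count (t ∷ H) ≡ ⟦ within S t ⟧ * (⟦ a ≤ᵇ l t ⟧ * count′ t H)
  split t H = rearrange (a ≤ᵇ l t) (lastsAscendFrom (l t) H) (within S t) (allWithin S H)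

-- Stars and bars: the e last coordinates ascend within S ∩ [a, n), leaving at most 2^(e + |S ∩ [a, n)|)
-- choices for them, and |S|^k choices for the other coordinates of each edge.
#ascendingWithin-≤ : (S : Subset n) (k e a : ℕ) →
  #ascendingWithin S k e a ≤ 2 ^ e * 2 ^ atOrAbove S a * (size S ^ k) ^ e
#ascendingWithin-≤ S k zero a =
  subst (1 ≤_) (sym (trans (*-identityʳ _) (*-identityˡ _))) (m^n>0 2 (atOrAbove S a))
#ascendingWithin-≤ {n} S k (suc e) a = begin
  #ascendingWithin S k (suc e) a
    ≡⟨ #ascendingWithin-suc S k e a ⟩
  ∑[ t ∈ U ] (⟦ within S t ⟧ * (⟦ a ≤ᵇ toℕ (last t) ⟧ * #ascendingWithin S k e (toℕ (last t))))
    ≤⟨ ∑-mono-≤ U (λ {t} _ → *-monoʳ-≤ ⟦ within S t ⟧ (*-monoʳ-≤ ⟦ a ≤ᵇ toℕ (last t) ⟧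
                              (#ascendingWithin-≤ S k e (toℕ (last t))))) ⟩
  ∑[ t ∈ U ] (⟦ within S t ⟧ * ψ (last t))
    ≡⟨ ∑-within-by-last S (allFin n) k ψ ⟩
  q * ∑[ x ∈ allFin n ] (⟦ lookup S x ⟧ * ψ x)
    ≡⟨ cong (q *_) (trans (∑-cong (allFin n) (λ {x} _ → reorder ⟦ lookup S x ⟧ ⟦ a ≤ᵇ toℕ x ⟧ _))
                          (sym (*-distribˡ-∑ (2 ^ e * q ^ e) (allFin n) _))) ⟩
  q * (2 ^ e * q ^ e * geometricSum S a)
    ≤⟨ *-monoʳ-≤ q (*-monoʳ-≤ (2 ^ e * q ^ e)
         (≤-trans (m≤m+n (geometricSum S a) 2) (≤-reflexive (geometricSum+2 S a)))) ⟩
  q * (2 ^ e * q ^ e * (2 * 2 ^ atOrAbove S a))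
    ≡⟨ collect q (2 ^ e) (q ^ e) (2 ^ atOrAbove S a) ⟩
  2 ^ suc e * 2 ^ atOrAbove S a * q ^ suc e
    ∎
  where
  open ≤-Reasoning
  U = allVecs (allFin n) (suc k)
  q = size S ^ k
  ψ : Fin n → ℕ
  ψ x = ⟦ a ≤ᵇ toℕ x ⟧ * (2 ^ e * 2 ^ atOrAbove S (toℕ x) * q ^ e)
  reorder : ∀ s b c → s * (b * (2 ^ e * c * q ^ e)) ≡ 2 ^ e * q ^ e * (s * (b * c))
  reorder s b c = lemma s b c (2 ^ e) (q ^ e)
    where
    lemma : ∀ s b c x y → s * (b * (x * c * y)) ≡ x * y * (s * (b * c))
    lemma = solve-∀
  collect : ∀ q x y c → q * (x * y * (2 * c)) ≡ 2 * x * c * (q * y)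
  collect = solve-∀

subsets : (n : ℕ) → List (Subset n)
subsets zero    = [] ∷ []
subsets (suc n) = map (false ∷_) (subsets n) ++ map (true ∷_) (subsets n)

∈-subsets : (S : Subset n) → S ∈ subsets n
∈-subsets         []      = here refl
∈-subsets {suc n} (false ∷ S) = ∈-++⁺ˡ (∈-map⁺ (false ∷_) (∈-subsets S))
∈-subsets {suc n} (true  ∷ S) = ∈-++⁺ʳ (map (false ∷_) (subsets n)) (∈-map⁺ (true ∷_) (∈-subsets S))

size-∷ : (b : Bool) (S : Subset n) → size (b ∷ S) ≡ ⟦ b ⟧ + size S
size-∷ {n} b S = ∑-allFin-suc n (λ x → ⟦ lookup (b ∷ S) x ⟧)

#subsetsOfSize : ℕ → ℕ → ℕ
#subsetsOfSize n j = ∑[ S ∈ subsets n ] ⟦ size S ≡ᵇ j ⟧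

#subsetsOfSize-suc : ∀ n j →
  #subsetsOfSize (suc n) j ≡ #subsetsOfSize n j + ∑[ S ∈ subsets n ] ⟦ suc (size S) ≡ᵇ j ⟧
#subsetsOfSize-suc n j = trans (∑-++ (map (false ∷_) (subsets n)) _ _) (cong₂ _+_ (branch false) (branch true))
  where
  branch : ∀ b → ∑[ S ∈ map (b ∷_) (subsets n) ] ⟦ size S ≡ᵇ j ⟧ ≡ ∑[ S ∈ subsets n ] ⟦ ⟦ b ⟧ + size S ≡ᵇ j ⟧
  branch b = trans (∑-map (b ∷_) (subsets n) _)
                   (∑-cong (subsets n) (λ {S} _ → cong (λ s → ⟦ s ≡ᵇ j ⟧) (size-∷ b S)))

#subsetsOfSize-0 : ∀ n → #subsetsOfSize n 0 ≡ 1
#subsetsOfSize-0 zero    = refl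
#subsetsOfSize-0 (suc n) = trans (#subsetsOfSize-suc n 0)
  (cong₂ _+_ (#subsetsOfSize-0 n) (∑-zero (subsets n)))

binomial-lower-bound : ∀ n j → n ^ suc j + suc j * n ^ j ≤ suc n ^ suc j
binomial-lower-bound n zero    = ≤-reflexive (lemma n)
  where
  lemma : ∀ n → n * 1 + 1 * 1 ≡ (1 + n) * 1
  lemma = solve-∀
binomial-lower-bound n (suc j) = begin
  n ^ suc (suc j) + suc (suc j) * n ^ suc j                       ≤⟨ m≤m+n _ (suc j * n ^ j) ⟩
  n ^ suc (suc j) + suc (suc j) * n ^ suc j + suc j * n ^ j       ≡⟨ expand n (n ^ j) j ⟩
  suc n * (n ^ suc j + suc j * n ^ j)                             ≤⟨ *-monoʳ-≤ (suc n) (binomial-lower-bound n j) ⟩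
  suc n ^ suc (suc j)                                             ∎
  where
  open ≤-Reasoning
  expand : ∀ n p j → n * (n * p) + (2 + j) * (n * p) + (1 + j) * p ≡ (1 + n) * (n * p + (1 + j) * p)
  expand = solve-∀

#subsetsOfSize*!≤^ : ∀ n j → #subsetsOfSize n j * j ! ≤ n ^ j
#subsetsOfSize*!≤^ zero    zero    = ≤-refl
#subsetsOfSize*!≤^ zero    (suc j) = z≤n
#subsetsOfSize*!≤^ (suc n) zero    = ≤-reflexive (cong (_* 1) (#subsetsOfSize-0 (suc n)))
#subsetsOfSize*!≤^ (suc n) (suc j) = begin
  #subsetsOfSize (suc n) (suc j) * suc j !                ≡⟨ cong (_* suc j !) (#subsetsOfSize-suc n (suc j)) ⟩
  (N (suc j) + N j) * suc j !                             ≡⟨ split (N (suc j)) (N j) (suc j) (j !) ⟩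
  N (suc j) * suc j ! + suc j * (N j * j !)               ≤⟨ +-mono-≤ (#subsetsOfSize*!≤^ n (suc j))
                                                                       (*-monoʳ-≤ (suc j) (#subsetsOfSize*!≤^ n j)) ⟩
  n ^ suc j + suc j * n ^ j                               ≤⟨ binomial-lower-bound n j ⟩
  suc n ^ suc j                                           ∎
  where
  open ≤-Reasoning
  N = #subsetsOfSize n
  split : ∀ a b s f → (a + b) * (s * f) ≡ a * (s * f) + s * (b * f)
  split = solve-∀

-- Weierstrass' product inequality (1 - 1/(k+1))^h ≥ 1 - h/(k+1), cleared of denominators.
weierstrass : ∀ h r k → h + r ≡ suc k → suc k ^ h * r ≤ k ^ h * suc k
weierstrass zero    r k eq = ≤-reflexive (trans (+-identityʳ r) (trans eq (sym (+-identityʳ (suc k)))))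
weierstrass (suc h) r k eq = begin
  suc k * suc k ^ h * r      ≡⟨ swap₁ (suc k) (suc k ^ h) r ⟩
  suc k ^ h * (suc k * r)    ≤⟨ *-monoʳ-≤ (suc k ^ h) step ⟩
  suc k ^ h * (k * suc r)    ≡⟨ swap₂ (suc k ^ h) k (suc r) ⟩
  k * (suc k ^ h * suc r)    ≤⟨ *-monoʳ-≤ k (weierstrass h (suc r) k (trans (+-suc h r) eq)) ⟩
  k * (k ^ h * suc k)        ≡⟨ *-assoc k (k ^ h) (suc k) ⟨
  k * k ^ h * suc k          ∎
  where
  open ≤-Reasoning
  swap₁ : ∀ a b c → a * b * c ≡ b * (a * c)
  swap₁ = solve-∀
  swap₂ : ∀ a b c → a * (b * c) ≡ b * (a * c)
  swap₂ = solve-∀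
  r≤k : r ≤ k
  r≤k = ≤-pred (subst (r <_) eq (s≤s (m≤n+m r h)))
  step : suc k * r ≤ k * suc r
  step = begin
    suc k * r    ≡⟨⟩
    r + k * r    ≤⟨ +-monoˡ-≤ (k * r) r≤k ⟩
    k + k * r    ≡⟨ *-suc k r ⟨
    k * suc r    ∎

suc^≤2*^ : ∀ a b → a ≤ suc b → suc (a + b) ^ a ≤ 2 * (a + b) ^ a
suc^≤2*^ a b a≤1+b = *-cancelʳ-≤ (suc s ^ a) (2 * s ^ a) (suc s) (begin
  suc s ^ a * suc s            ≤⟨ *-monoʳ-≤ (suc s ^ a) s<2[1+b] ⟩
  suc s ^ a * (2 * suc b)      ≡⟨ swap (suc s ^ a) (suc b) ⟩
  2 * (suc s ^ a * suc b)      ≤⟨ *-monoʳ-≤ 2 (weierstrass a (suc b) s (+-suc a b)) ⟩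
  2 * (s ^ a * suc s)          ≡⟨ *-assoc 2 (s ^ a) (suc s) ⟨
  2 * s ^ a * suc s            ∎)
  where
  open ≤-Reasoning
  s = a + b
  swap : ∀ x y → x * (2 * y) ≡ 2 * (x * y)
  swap = solve-∀
  double : ∀ b → 1 + (1 + b + b) ≡ 2 * (1 + b)
  double = solve-∀
  s<2[1+b] : suc s ≤ 2 * suc b
  s<2[1+b] = ≤-trans (s≤s (+-monoˡ-≤ b a≤1+b)) (≤-reflexive (double b))

-- Each half of the exponent contributes a factor 2.
suc^≤4*^ : ∀ a b → a ≤ suc b → b ≤ suc a → suc (a + b) ^ (a + b) ≤ 4 * (a + b) ^ (a + b)
suc^≤4*^ a b a≤1+b b≤1+a = begin
  suc s ^ (a + b)              ≡⟨ ^-distribˡ-+-* (suc s) a b ⟩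
  suc s ^ a * suc s ^ b        ≤⟨ *-mono-≤ (suc^≤2*^ a b a≤1+b)
                                           (subst (λ i → suc i ^ b ≤ 2 * i ^ b) (+-comm b a) (suc^≤2*^ b a b≤1+a)) ⟩
  2 * s ^ a * (2 * s ^ b)      ≡⟨ regroup (s ^ a) (s ^ b) ⟩
  4 * (s ^ a * s ^ b)          ≡⟨ cong (4 *_) (^-distribˡ-+-* s a b) ⟨
  4 * s ^ (a + b)              ∎
  where
  open ≤-Reasoning
  s = a + b
  regroup : ∀ x y → 2 * x * (2 * y) ≡ 4 * (x * y)
  regroup = solve-∀

⌈n/2⌉≤1+⌊n/2⌋ : ∀ n → ⌈ n /2⌉ ≤ suc ⌊ n /2⌋
⌈n/2⌉≤1+⌊n/2⌋ zero          = z≤n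
⌈n/2⌉≤1+⌊n/2⌋ (suc zero)    = s≤s z≤n
⌈n/2⌉≤1+⌊n/2⌋ (suc (suc n)) = s≤s (⌈n/2⌉≤1+⌊n/2⌋ n)

suc^n≤4*^n : ∀ k → suc k ^ k ≤ 4 * k ^ k
suc^n≤4*^n k = subst (λ i → suc i ^ i ≤ 4 * i ^ i) (⌊n/2⌋+⌈n/2⌉≡n k)
  (suc^≤4*^ ⌊ k /2⌋ ⌈ k /2⌉ (≤-trans (⌊n/2⌋≤⌈n/2⌉ k) (n≤1+n _)) (⌈n/2⌉≤1+⌊n/2⌋ k))

n^n≤4^n*n! : ∀ k → k ^ k ≤ 4 ^ k * k !
n^n≤4^n*n! zero    = ≤-refl
n^n≤4^n*n! (suc k) = begin
  suc k * suc k ^ k              ≤⟨ *-monoʳ-≤ (suc k) (suc^n≤4*^n k) ⟩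
  suc k * (4 * k ^ k)            ≤⟨ *-monoʳ-≤ (suc k) (*-monoʳ-≤ 4 (n^n≤4^n*n! k)) ⟩
  suc k * (4 * (4 ^ k * k !))    ≡⟨ regroup (suc k) (4 ^ k) (k !) ⟩
  4 * 4 ^ k * (suc k * k !)      ∎
  where
  open ≤-Reasoning
  regroup : ∀ a b c → a * (4 * (b * c)) ≡ 4 * b * (a * c)
  regroup = solve-∀

^-distribʳ-* : ∀ a b j → (a * b) ^ j ≡ a ^ j * b ^ j
^-distribʳ-* a b zero    = refl
^-distribʳ-* a b (suc j) = trans (cong (a * b *_) (^-distribʳ-* a b j)) (interchange a b (a ^ j) (b ^ j))
  where
  interchange : ∀ a b x y → a * b * (x * y) ≡ a * x * (b * y)
  interchange = solve-∀

#subsetsOfSize*^≤ : ∀ n j → #subsetsOfSize n j * j ^ j ≤ (4 * n) ^ j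
#subsetsOfSize*^≤ n j = begin
  N * j ^ j              ≤⟨ *-monoʳ-≤ N (n^n≤4^n*n! j) ⟩
  N * (4 ^ j * j !)      ≡⟨ swap N (4 ^ j) (j !) ⟩
  4 ^ j * (N * j !)      ≤⟨ *-monoʳ-≤ (4 ^ j) (#subsetsOfSize*!≤^ n j) ⟩
  4 ^ j * n ^ j          ≡⟨ ^-distribʳ-* 4 n j ⟨
  (4 * n) ^ j            ∎
  where
  open ≤-Reasoning
  N = #subsetsOfSize n j
  swap : ∀ a b c → a * (b * c) ≡ b * (a * c)
  swap = solve-∀

#subsetsOfSize-term-≤ : ∀ n m e j E → j ≤ m → e ≤ m → m ≤ n → e + E ≡ 2 * m →
  #subsetsOfSize n j * (2 ^ e * 2 ^ j * j ^ E) ≤ 16 ^ m * n ^ m * m ^ (m ∸ e)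
#subsetsOfSize-term-≤ n m e j E j≤m e≤m m≤n e+E≡2m = begin
  N * (2 ^ e * 2 ^ j * j ^ E)
    ≡⟨ cong (λ i → N * (2 ^ e * 2 ^ j * j ^ i)) E≡ ⟨
  N * (2 ^ e * 2 ^ j * j ^ (j + (m ∸ j + (m ∸ e))))
    ≡⟨ cong (λ x → N * (2 ^ e * 2 ^ j * x)) (^-distrib₃ j j (m ∸ j) (m ∸ e)) ⟩
  N * (2 ^ e * 2 ^ j * (j ^ j * (j ^ (m ∸ j) * j ^ (m ∸ e))))
    ≡⟨ regroup₁ N (2 ^ e) (2 ^ j) (j ^ j) (j ^ (m ∸ j)) (j ^ (m ∸ e)) ⟩
  2 ^ e * 2 ^ j * (N * j ^ j) * (j ^ (m ∸ j) * j ^ (m ∸ e))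
    ≤⟨ *-mono-≤ (*-mono-≤ (*-mono-≤ (^-monoʳ-≤ 2 e≤m) (^-monoʳ-≤ 2 j≤m)) (#subsetsOfSize*^≤ n j))
                (*-mono-≤ (^-monoˡ-≤ (m ∸ j) (≤-trans j≤m m≤n)) (^-monoˡ-≤ (m ∸ e) j≤m)) ⟩
  2 ^ m * 2 ^ m * (4 * n) ^ j * (n ^ (m ∸ j) * m ^ (m ∸ e))
    ≡⟨ cong (λ x → 2 ^ m * 2 ^ m * x * (n ^ (m ∸ j) * m ^ (m ∸ e))) (^-distribʳ-* 4 n j) ⟩
  2 ^ m * 2 ^ m * (4 ^ j * n ^ j) * (n ^ (m ∸ j) * m ^ (m ∸ e))
    ≡⟨ regroup₂ (2 ^ m) (4 ^ j) (n ^ j) (n ^ (m ∸ j)) (m ^ (m ∸ e)) ⟩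
  2 ^ m * 2 ^ m * 4 ^ j * (n ^ j * n ^ (m ∸ j)) * m ^ (m ∸ e)
    ≤⟨ *-monoˡ-≤ (m ^ (m ∸ e)) (*-monoˡ-≤ (n ^ j * n ^ (m ∸ j)) (*-monoʳ-≤ (2 ^ m * 2 ^ m) (^-monoʳ-≤ 4 j≤m))) ⟩
  2 ^ m * 2 ^ m * 4 ^ m * (n ^ j * n ^ (m ∸ j)) * m ^ (m ∸ e)
    ≡⟨ cong₂ (λ x y → x * y * m ^ (m ∸ e)) sixteen
             (trans (sym (^-distribˡ-+-* n j (m ∸ j))) (cong (n ^_) (m+[n∸m]≡n j≤m))) ⟩
  16 ^ m * n ^ m * m ^ (m ∸ e)
    ∎
  where
  open ≤-Reasoning
  N = #subsetsOfSize n j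
  E≡ : j + (m ∸ j + (m ∸ e)) ≡ E
  E≡ = +-cancelˡ-≡ e _ _ (begin-equality
    e + (j + (m ∸ j + (m ∸ e)))   ≡⟨ shuffle e j (m ∸ j) (m ∸ e) ⟩
    (j + (m ∸ j)) + (m ∸ e + e)   ≡⟨ cong₂ _+_ (m+[n∸m]≡n j≤m) (m∸n+n≡m e≤m) ⟩
    m + m                         ≡⟨ cong (m +_) (+-identityʳ m) ⟨
    2 * m                         ≡⟨ e+E≡2m ⟨
    e + E                         ∎)
    where
    shuffle : ∀ e j a b → e + (j + (a + b)) ≡ (j + a) + (b + e)
    shuffle = solve-∀
  ^-distrib₃ : ∀ x a b c → x ^ (a + (b + c)) ≡ x ^ a * (x ^ b * x ^ c)
  ^-distrib₃ x a b c = trans (^-distribˡ-+-* x a (b + c)) (cong (x ^ a *_) (^-distribˡ-+-* x b c))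
  regroup₁ : ∀ N a b c d f → N * (a * b * (c * (d * f))) ≡ a * b * (N * c) * (d * f)
  regroup₁ = solve-∀
  regroup₂ : ∀ t f a b c → t * t * (f * a) * (b * c) ≡ t * t * f * (a * b) * c
  regroup₂ = solve-∀
  sixteen : 2 ^ m * 2 ^ m * 4 ^ m ≡ 16 ^ m
  sixteen = trans (cong (_* 4 ^ m) (sym (^-distribʳ-* 2 2 m))) (sym (^-distribʳ-* 4 4 m))

n<2^n : ∀ m → m < 2 ^ m
n<2^n zero    = s≤s z≤n
n<2^n (suc m) = +-mono-≤ (m^n>0 2 m) (subst (suc m ≤_) (sym (+-identityʳ (2 ^ m))) (n<2^n m))

sum-over-sizes-≤ : ∀ n m e D .{{_ : NonZero D}} → m ≤ D * e →
  suc m * (16 ^ m * n ^ m * m ^ (m ∸ e)) ≤ (32 * D * n) ^ m * e ^ (m ∸ e)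
sum-over-sizes-≤ n m e D m≤De = begin
  suc m * (16 ^ m * n ^ m * m ^ (m ∸ e))
    ≤⟨ *-mono-≤ (n<2^n m) (*-monoʳ-≤ (16 ^ m * n ^ m) (^-monoˡ-≤ (m ∸ e) m≤De)) ⟩
  2 ^ m * (16 ^ m * n ^ m * (D * e) ^ (m ∸ e))
    ≡⟨ cong (λ x → 2 ^ m * (16 ^ m * n ^ m * x)) (^-distribʳ-* D e (m ∸ e)) ⟩
  2 ^ m * (16 ^ m * n ^ m * (D ^ (m ∸ e) * e ^ (m ∸ e)))
    ≤⟨ *-monoʳ-≤ (2 ^ m) (*-monoʳ-≤ (16 ^ m * n ^ m) (*-monoˡ-≤ (e ^ (m ∸ e)) (^-monoʳ-≤ D (m∸n≤m m e)))) ⟩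
  2 ^ m * (16 ^ m * n ^ m * (D ^ m * e ^ (m ∸ e)))
    ≡⟨ regroup (2 ^ m) (16 ^ m) (n ^ m) (D ^ m) (e ^ (m ∸ e)) ⟩
  2 ^ m * 16 ^ m * D ^ m * n ^ m * e ^ (m ∸ e)
    ≡⟨ cong (λ x → x * n ^ m * e ^ (m ∸ e)) (trans (cong (_* D ^ m) (sym (^-distribʳ-* 2 16 m)))
                                                   (sym (^-distribʳ-* 32 D m))) ⟩
  (32 * D) ^ m * n ^ m * e ^ (m ∸ e)
    ≡⟨ cong (_* e ^ (m ∸ e)) (^-distribʳ-* (32 * D) n m) ⟨
  (32 * D * n) ^ m * e ^ (m ∸ e)
    ∎
  where
  open ≤-Reasoning
  regroup : ∀ a b c d f → a * (b * c * (d * f)) ≡ a * b * d * c * f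
  regroup = solve-∀

countEvenHypergraphs-≤-∑-subsets : ∀ k n e m → suc k * e ≡ 2 * m →
  countEvenHypergraphs (suc k) n e ≤ ∑[ S ∈ subsets n ] (⟦ size S ≤ᵇ m ⟧ * #ascendingWithin S k e 0)
countEvenHypergraphs-≤-∑-subsets k n e m De≡2m = begin
  countEvenHypergraphs (suc k) n e
    ≡⟨ countEvenHypergraphs≡∑ (suc k) n e ⟩
  ∑[ H ∈ Hs ] ⟦ countedᵇ H ⟧
    ≤⟨ ∑-mono-≤ Hs (λ {H} _ → counted≤ H) ⟩
  ∑[ H ∈ Hs ] ∑[ S ∈ subsets n ] F S H
    ≡⟨ ∑-comm Hs (subsets n) (λ H S → F S H) ⟩
  ∑[ S ∈ subsets n ] ∑[ H ∈ Hs ] F S H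
    ≡⟨ ∑-cong (subsets n) (λ {S} _ → *-distribˡ-∑ ⟦ size S ≤ᵇ m ⟧ Hs _) ⟨
  ∑[ S ∈ subsets n ] (⟦ size S ≤ᵇ m ⟧ * #ascendingWithin S k e 0)
    ∎
  where
  open ≤-Reasoning
  Hs = hypergraphs n (suc k) e
  F : Subset n → Vec (Tuple n (suc k)) e → ℕ
  F S H = ⟦ size S ≤ᵇ m ⟧ * ⟦ ascendingWithin S 0 H ⟧
  counted≤ : ∀ H → ⟦ countedᵇ H ⟧ ≤ ∑[ S ∈ subsets n ] F S H
  counted≤ H with sortedᵇ H in sorted | allDegreesEven H in even
  ... | false | _     = z≤n
  ... | true  | false = z≤n
  ... | true  | true  = subst (_≤ ∑[ S ∈ subsets n ] F S H) supportCounts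
                                (∈⇒≤∑ (λ S → F S H) (∈-subsets (support H)))
    where
    size≤m : size (support H) ≤ m
    size≤m = *-cancelˡ-≤ 2 (subst (2 * size (support H) ≤_) (trans (*-comm e (suc k)) De≡2m) (2*size-support≤ H even))
    supportCounts : F (support H) H ≡ 1
    supportCounts rewrite T⇒≡true (≤⇒≤ᵇ size≤m) | sorted⇒lastsAscend H sorted | allWithin-support H = refl

∑-subsets-by-size : ∀ n m (g : ℕ → ℕ) →
  ∑[ S ∈ subsets n ] (⟦ size S ≤ᵇ m ⟧ * g (size S)) ≤ ∑[ j ∈ downFrom (suc m) ] (#subsetsOfSize n j * g j)
∑-subsets-by-size n m g = begin
  ∑[ S ∈ subsets n ] (⟦ size S ≤ᵇ m ⟧ * g (size S))
    ≤⟨ ∑-mono-≤ (subsets n) (λ {S} _ → sizeTerm (size S)) ⟩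
  ∑[ S ∈ subsets n ] ∑[ j ∈ js ] (⟦ size S ≡ᵇ j ⟧ * g j)
    ≡⟨ ∑-comm (subsets n) js (λ S j → ⟦ size S ≡ᵇ j ⟧ * g j) ⟩
  ∑[ j ∈ js ] ∑[ S ∈ subsets n ] (⟦ size S ≡ᵇ j ⟧ * g j)
    ≡⟨ ∑-cong js (λ {j} _ → *-distribʳ-∑ (g j) (subsets n) _) ⟨
  ∑[ j ∈ js ] (#subsetsOfSize n j * g j)
    ∎
  where
  open ≤-Reasoning
  js = downFrom (suc m)
  sizeTerm : ∀ s → ⟦ s ≤ᵇ m ⟧ * g s ≤ ∑[ j ∈ js ] (⟦ s ≡ᵇ j ⟧ * g j)
  sizeTerm s with s ≤ᵇ m in s≤ᵇm
  ... | false = z≤n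
  ... | true  = subst (_≤ ∑[ j ∈ js ] (⟦ s ≡ᵇ j ⟧ * g j))
                      (cong (λ b → ⟦ b ⟧ * g s) (T⇒≡true (≡⇒≡ᵇ s s refl)))
                      (∈⇒≤∑ (λ j → ⟦ s ≡ᵇ j ⟧ * g j) (∈-downFrom⁺ (s≤s (≤ᵇ⇒≤ s m (≡true⇒T s≤ᵇm)))))

countEvenHypergraphs-even-≤ : ∀ D n e m → 2 ≤ D → D * e ≡ 2 * m → m ≤ n →
  countEvenHypergraphs D n e ≤ (32 * D * n) ^ m * e ^ (m ∸ e)
countEvenHypergraphs-even-≤ (suc k) n e m (s≤s 1≤k) De≡2m m≤n = begin
  countEvenHypergraphs (suc k) n e
    ≤⟨ countEvenHypergraphs-≤-∑-subsets k n e m De≡2m ⟩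
  ∑[ S ∈ subsets n ] (⟦ size S ≤ᵇ m ⟧ * #ascendingWithin S k e 0)
    ≤⟨ ∑-mono-≤ (subsets n) (λ {S} _ → *-monoʳ-≤ ⟦ size S ≤ᵇ m ⟧ (#ascendingWithin≤g S)) ⟩
  ∑[ S ∈ subsets n ] (⟦ size S ≤ᵇ m ⟧ * g (size S))
    ≤⟨ ∑-subsets-by-size n m g ⟩
  ∑[ j ∈ downFrom (suc m) ] (#subsetsOfSize n j * g j)
    ≤⟨ ∑-mono-≤ (downFrom (suc m)) (λ j∈ →
         #subsetsOfSize-term-≤ n m e _ (k * e) (≤-pred (∈-downFrom⁻ j∈)) e≤m m≤n De≡2m) ⟩
  ∑[ _ ∈ downFrom (suc m) ] K
    ≡⟨ trans (∑-const (downFrom (suc m)) K) (cong (_* K) (length-downFrom (suc m))) ⟩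
  suc m * K
    ≤⟨ sum-over-sizes-≤ n m e (suc k) m≤De ⟩
  (32 * suc k * n) ^ m * e ^ (m ∸ e)
    ∎
  where
  open ≤-Reasoning
  K = 16 ^ m * n ^ m * m ^ (m ∸ e)
  g : ℕ → ℕ
  g j = 2 ^ e * 2 ^ j * j ^ (k * e)
  #ascendingWithin≤g : (S : Subset n) → #ascendingWithin S k e 0 ≤ g (size S)
  #ascendingWithin≤g S = subst₂ (λ c x → #ascendingWithin S k e 0 ≤ 2 ^ e * 2 ^ c * x)
    (sym (size≡atOrAbove-0 S)) (^-*-assoc (size S) k e) (#ascendingWithin-≤ S k e 0)
  e≤m : e ≤ m
  e≤m = *-cancelˡ-≤ 2 (subst (2 * e ≤_) De≡2m (*-monoˡ-≤ e (s≤s 1≤k)))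
  m≤De : m ≤ suc k * e
  m≤De = subst (m ≤_) (sym De≡2m) (m≤n*m m 2)

%2≡0⇒≡2*[/2] : ∀ x → x % 2 ≡ 0 → x ≡ 2 * (x / 2)
%2≡0⇒≡2*[/2] x x%2≡0 = trans (m≡m%n+[m/n]*n x 2) (trans (cong (_+ x / 2 * 2) x%2≡0) (*-comm (x / 2) 2))

[D∸2]*e/2≡m∸e : ∀ D e m → D * e ≡ 2 * m → ((D ∸ 2) * e) / 2 ≡ m ∸ e
[D∸2]*e/2≡m∸e D e m De≡2m = begin-equality
  ((D ∸ 2) * e) / 2      ≡⟨ cong (_/ 2) (*-distribʳ-∸ e D 2) ⟩
  (D * e ∸ 2 * e) / 2    ≡⟨ cong (λ x → (x ∸ 2 * e) / 2) De≡2m ⟩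
  (2 * m ∸ 2 * e) / 2    ≡⟨ cong (_/ 2) (*-distribˡ-∸ 2 m e) ⟨
  (2 * (m ∸ e)) / 2      ≡⟨ cong (_/ 2) (*-comm 2 (m ∸ e)) ⟩
  ((m ∸ e) * 2) / 2      ≡⟨ m*n/n≡m (m ∸ e) 2 ⟩
  m ∸ e                  ∎
  where open ≤-Reasoning

lemma4p14 : Σ ℕ λ C → 0 < C ×
    ((D d e n : ℕ) → 2 < D → e ≤ d → d * D ≤ 2 * n →
      ((D * e) % 2 ≡ 0 →
        countEvenHypergraphs D n e ≤ (C * D * n) ^ ((D * e) / 2) * e ^ (((D ∸ 2) * e) / 2))
      × ((D * e) % 2 ≡ 1 → countEvenHypergraphs D n e ≡ 0))
lemma4p14 = 32 , s≤s z≤n , λ D d e n 2<D e≤d dD≤2n → even D d e n 2<D e≤d dD≤2n , countEvenHypergraphs-odd D n e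
  where
  even : ∀ D d e n → 2 < D → e ≤ d → d * D ≤ 2 * n → (D * e) % 2 ≡ 0 →
    countEvenHypergraphs D n e ≤ (32 * D * n) ^ ((D * e) / 2) * e ^ (((D ∸ 2) * e) / 2)
  even D d e n 2<D e≤d dD≤2n De-even =
    subst (λ x → countEvenHypergraphs D n e ≤ (32 * D * n) ^ m * e ^ x) (sym ([D∸2]*e/2≡m∸e D e m De≡2m))
          (countEvenHypergraphs-even-≤ D n e m (<⇒≤ 2<D) De≡2m m≤n)
    where
    m = (D * e) / 2
    De≡2m : D * e ≡ 2 * m
    De≡2m = %2≡0⇒≡2*[/2] (D * e) De-even
    m≤n : m ≤ n
    m≤n = *-cancelˡ-≤ 2 (begin
      2 * m   ≡⟨ De≡2m ⟨
      D * e   ≤⟨ *-monoʳ-≤ D e≤d ⟩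
      D * d   ≡⟨ *-comm D d ⟩
      d * D   ≤⟨ dD≤2n ⟩
      2 * n   ∎)
      where open ≤-Reasoning
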